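{- Let $\Sigma,\Gamma$ be finite alphabets with at least two letters each and $\mathcal{I}$ the set of injective morphisms $\Sigma^*\to\Gamma^*$. For every infinite word $w\in\Sigma^{\mathbb{N}}$, $$\mathrm{ACE}_{\mathcal{I}}(w)=\sup_{h\in\mathcal{I}}\Big(\limsup_{n\to\infty}\{\mathrm{E}(h(f))\mid f\in\mathrm{Fact}_n(w)\}\Big).$$
   Context: For a nonempty word $v$ and natural number $p$, $v^{p/|v|}$ is the prefix of length $p$ of $vvv\cdots$. The fractional exponent of a nonempty finite word $u$ is $\mathrm{E}(u)=\sup\{r\in\mathbb{Q}\mid\exists v\ne\varepsilon: u=v^r\}$. $\mathrm{Fact}_n(w)$ is the set of factors of length $n$ of $w$, and for sets $S_n$ of reals, $\limsup_{n\to\infty}S_n$ means $\lim_{N\to\infty}\sup\bigcup_{n\ge N}S_n$. For an infinite word $w$, $\mathrm{ACE}(w)=\limsup_{n\to\infty}\{\mathrm{E}(u)\mid u\in\mathrm{Fact}_n(w)\}$ and $\mathrm{ACE}_{\mathcal{I}}(w)=\sup\{\mathrm{ACE}(h(w))\mid h\in\mathcal{I}\}$, morphisms extended letterwise to infinite words. -}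

module Defs where

open import Data.Nat using (ℕ; zero; suc; _+_; _≤_)
open import Data.Fin using (Fin)
open import Data.List using (List; []; _∷_; length; take; concat; replicate; concatMap)
open import Data.Integer using (+_)
open import Data.Rational using (ℚ; _/_; _<_)
open import Data.Product using (Σ; ∃; _×_)
open import Relation.Binary.PropositionalEquality using (_≡_)

InfWord : Set → Set
InfWord A = ℕ → A

factor : {A : Set} → InfWord A → ℕ → ℕ → List A
factor w i zero    = []
factor w i (suc n) = w i ∷ factor w (suc i) n

-- v^{p/|v|} for a nonempty word v = a ∷ vs : the prefix of length p of vvv...
-- (concatenating p copies of v yields a word of length ≥ p).
pow : {A : Set} → A → List A → ℕ → List A
pow a vs p = take p (concat (replicate p (a ∷ vs)))

IsPower : {A : Set} → List A → A → List A → ℚ → Set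
IsPower u a vs r =
  Σ ℕ (λ p → (u ≡ pow a vs p) × (r ≡ (+ p) / suc (length vs)))

-- q < E(u), where E(u) = sup { r ∈ ℚ | ∃ v ≠ ε, u = v^r }.
BelowE : {A : Set} → ℚ → List A → Set
BelowE {A} q u = Σ A (λ a → Σ (List A) (λ vs → Σ ℚ (λ r → IsPower u a vs r × (q < r))))

-- Given a family of sets S_n of rationals, described by
--   Above n q  :=  "∃ x ∈ S_n with q < x",
-- this is  q < limsup_{n→∞} S_n  (= lim_N sup ⋃_{n≥N} S_n, a value in [-∞,∞]).
BelowLimsup : (ℕ → ℚ → Set) → ℚ → Set
BelowLimsup Above q = Σ ℚ (λ q' → (q < q') × ((N : ℕ) → Σ ℕ (λ n → (N ≤ n) × Above n q')))

-- Morphisms Σ* → Γ* are determined by the images of letters.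
Morphism : ℕ → ℕ → Set
Morphism k m = Fin k → List (Fin m)

ext : {k m : ℕ} → Morphism k m → List (Fin k) → List (Fin m)
ext h u = concatMap h u

Injective : {k m : ℕ} → Morphism k m → Set
Injective h = ∀ u v → ext h u ≡ ext h v → u ≡ v

at : {A : Set} → A → List A → ℕ → A
at d []       _       = d
at d (x ∷ xs) zero    = x
at d (x ∷ xs) (suc p) = at d xs p

-- For a non-erasing morphism (in particular an injective one)
-- h(w[0..p]) has length ≥ p+1, so the default letter is never used.
applyInf : {k m : ℕ} → Morphism k (suc m) → InfWord (Fin k) → InfWord (Fin (suc m))
applyInf h w p = at Fin.zero (ext h (factor w 0 (suc p))) p
  where import Data.Fin as Fin

-- q < ACE(x) = limsup_n { E(u) | u ∈ Fact_n(x) }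
BelowACE : {A : Set} → InfWord A → ℚ → Set
BelowACE x = BelowLimsup (λ n q' → Σ ℕ (λ i → BelowE q' (factor x i n)))

-- q < ACE_I(w) = sup { ACE(h(w)) | h ∈ I },  I = injective morphisms
BelowACE-I : (k m : ℕ) → InfWord (Fin (suc (suc k))) → ℚ → Set
BelowACE-I k m w q =
  Σ (Morphism (suc (suc k)) (suc (suc m))) (λ h → Injective h × BelowACE (applyInf h w) q)

-- q < sup_{h ∈ I} limsup_n { E(h(f)) | f ∈ Fact_n(w) }
BelowRHS : (k m : ℕ) → InfWord (Fin (suc (suc k))) → ℚ → Set
BelowRHS k m w q =
  Σ (Morphism (suc (suc k)) (suc (suc m))) (λ h → Injective h ×
    BelowLimsup (λ n q' → Σ ℕ (λ i → BelowE q' (ext h (factor w i n)))) q)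

-- Each h(f) is itself a factor of h(w), of length at least |f|, so the right-hand
-- side is at most ACE(h(w)).  Conversely, a long factor u of h(w) with period d
-- and |u|/d > q' contains a block h(f) of whole letter images which keeps the
-- period d and misses at most 2L letters of u, L bounding the letter images; f is
-- long since |h(f)| ≤ L|f|.  The exponent |h(f)|/d ≥ |u|/d − 2L/d of the block then
-- exceeds any q'' < q' once |u| is large: either d is large and 2L/d is small, or
-- d is small and |h(f)|/d is large anyway.

module Submission where

open import Defs
open import Data.Nat using (ℕ; zero; suc; _+_; _*_; _∸_; _≤_; _<_; z≤n; s≤s; NonZero; >-nonZero; _≤?_; _<?_)
open import Data.Nat.DivMod using (_%_; _/_; m≡m%n+[m/n]*n; [m+n]%n≡m%n; m<n⇒m%n≡m; m%n<n)
open import Data.Nat.Properties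
open import Data.Nat.Tactic.RingSolver using (solve)
open import Data.Fin using (Fin)
import Data.Fin as Fin
open import Data.Integer using (+_; -[1+_])
import Data.Integer as ℤ
import Data.Integer.Properties as ℤ
open import Data.Rational using (ℚ; mkℚ; ↥_; ↧_)
import Data.Rational as ℚ
import Data.Rational.Properties as ℚ
import Data.Rational.Unnormalised as ℚᵘ
import Data.Rational.Unnormalised.Properties as ℚᵘ
open import Data.List using (List; []; _∷_; _++_; length; take; concat; replicate; map; allFin)
open import Data.List.Properties using (length-++; length-take; concatMap-++; ++-identityʳ)
open import Data.List.Extrema.Nat using (max; xs≤max)
import Data.List.Relation.Unary.All as All
open import Data.List.Membership.Propositional.Properties using (∈-map⁺; ∈-allFin)
open import Data.Product using (Σ; ∃; ∃₂; _×_; _,_)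
open import Data.Sum using (inj₁; inj₂)
open import Data.Empty using (⊥-elim)
open import Function using (_∘_)
open import Function.Bundles using (_⇔_; mk⇔)
open import Relation.Binary.PropositionalEquality
open import Relation.Nullary using (yes; no)

module _ {A : Set} where

  at-++ˡ : (c : A) (xs ys : List A) {s : ℕ} → s < length xs → at c (xs ++ ys) s ≡ at c xs s
  at-++ˡ c (x ∷ xs) ys {zero}  _         = refl
  at-++ˡ c (x ∷ xs) ys {suc s} (s≤s s<n) = at-++ˡ c xs ys s<n

  at-++-≥ : (c : A) (xs ys : List A) {s : ℕ} → length xs ≤ s → at c (xs ++ ys) s ≡ at c ys (s ∸ length xs)
  at-++-≥ c []       ys _                  = refl
  at-++-≥ c (x ∷ xs) ys {suc s} (s≤s n≤s) = at-++-≥ c xs ys n≤s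

  at-take : (c : A) (n : ℕ) (ys : List A) {s : ℕ} → s < n → at c (take n ys) s ≡ at c ys s
  at-take c (suc n) []       _         = refl
  at-take c (suc n) (y ∷ ys) {zero}  _ = refl
  at-take c (suc n) (y ∷ ys) {suc s} (s≤s s<n) = at-take c n ys s<n

  at-ext : (c : A) (xs ys : List A) → length xs ≡ length ys →
           (∀ s → s < length xs → at c xs s ≡ at c ys s) → xs ≡ ys
  at-ext c []       []       _  _   = refl
  at-ext c (x ∷ xs) (y ∷ ys) eq ats =
    cong₂ _∷_ (ats 0 (s≤s z≤n)) (at-ext c xs ys (suc-injective eq) (λ s lt → ats (suc s) (s≤s lt)))

  length-factor : (x : InfWord A) (j n : ℕ) → length (factor x j n) ≡ n
  length-factor x j zero    = refl
  length-factor x j (suc n) = cong suc (length-factor x (suc j) n)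

  at-factor : (c : A) (x : InfWord A) (j n : ℕ) {s : ℕ} → s < n → at c (factor x j n) s ≡ x (j + s)
  at-factor c x j (suc n) {zero}  _         = cong x (sym (+-identityʳ j))
  at-factor c x j (suc n) {suc s} (s≤s s<n) = trans (at-factor c x (suc j) n s<n) (cong x (sym (+-suc j s)))

  factor-+ : (x : InfWord A) (j a b : ℕ) → factor x j (a + b) ≡ factor x j a ++ factor x (j + a) b
  factor-+ x j zero    b = cong (λ i → factor x i b) (sym (+-identityʳ j))
  factor-+ x j (suc a) b = cong (x j ∷_) (trans (factor-+ x (suc j) a b)
                                                (cong (λ i → factor x (suc j) a ++ factor x i b) (sym (+-suc j a))))

  length-pow : (a : A) (vs : List A) (p : ℕ) → length (pow a vs p) ≡ p
  length-pow a vs p = trans (length-take p _) (m≤n⇒m⊓n≡m (≤-length-cycle p))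
    where
    ≤-length-cycle : ∀ k → k ≤ length (concat (replicate k (a ∷ vs)))
    ≤-length-cycle zero    = z≤n
    ≤-length-cycle (suc k) = subst (suc k ≤_) (sym (length-++ (a ∷ vs)))
                                   (s≤s (≤-trans (≤-length-cycle k) (m≤n+m _ (length vs))))

  at-cycle : (c a : A) (vs : List A) (k s : ℕ) → s < k * suc (length vs) →
             at c (concat (replicate k (a ∷ vs))) s ≡ at c (a ∷ vs) (s % suc (length vs))
  at-cycle c a vs (suc k) s s<kd with s <? suc (length vs)
  ... | yes s<d = trans (at-++ˡ c (a ∷ vs) _ s<d) (cong (at c (a ∷ vs)) (sym (m<n⇒m%n≡m s<d)))
  ... | no  s≮d = begin
    at c (a ∷ vs ++ concat (replicate k (a ∷ vs))) s ≡⟨ at-++-≥ c (a ∷ vs) _ d≤s ⟩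
    at c (concat (replicate k (a ∷ vs))) (s ∸ d)    ≡⟨ at-cycle c a vs k (s ∸ d) s∸d<kd ⟩
    at c (a ∷ vs) ((s ∸ d) % d)                      ≡⟨ cong (at c (a ∷ vs)) (sym ([m+n]%n≡m%n (s ∸ d) d)) ⟩
    at c (a ∷ vs) ((s ∸ d + d) % d)                  ≡⟨ cong (λ s → at c (a ∷ vs) (s % d)) (m∸n+n≡m d≤s) ⟩
    at c (a ∷ vs) (s % d)                            ∎
    where
    open ≡-Reasoning
    d = suc (length vs)
    d≤s : d ≤ s
    d≤s = ≮⇒≥ s≮d
    s∸d<kd : s ∸ d < k * d
    s∸d<kd = +-cancelˡ-< d (s ∸ d) (k * d) (subst (_< d + k * d) (sym (m+[n∸m]≡n d≤s)) s<kd)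

  at-pow : (c a : A) (vs : List A) {p s : ℕ} → s < p → at c (pow a vs p) s ≡ at c (a ∷ vs) (s % suc (length vs))
  at-pow c a vs {p} s<p =
    trans (at-take c p _ s<p) (at-cycle c a vs p _ (<-≤-trans s<p (m≤m*n p (suc (length vs)))))

HasPeriod : {A : Set} → InfWord A → ℕ → ℕ → ℕ → Set
HasPeriod x j n d = ∀ s → s + d < n → x (j + s) ≡ x (j + (s + d))

module _ {A : Set} (x : InfWord A) where

  pow⇒HasPeriod : (j n : ℕ) (a : A) (vs : List A) → factor x j n ≡ pow a vs n →
                  HasPeriod x j n (suc (length vs))
  pow⇒HasPeriod j n a vs eq s s+d<n = begin
    x (j + s)                    ≡⟨ sym (at-factor a x j n s<n) ⟩
    at a (factor x j n) s        ≡⟨ cong (λ u → at a u s) eq ⟩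
    at a (pow a vs n) s          ≡⟨ at-pow a a vs s<n ⟩
    at a (a ∷ vs) (s % d)        ≡⟨ cong (at a (a ∷ vs)) (sym ([m+n]%n≡m%n s d)) ⟩
    at a (a ∷ vs) ((s + d) % d)  ≡⟨ sym (at-pow a a vs s+d<n) ⟩
    at a (pow a vs n) (s + d)    ≡⟨ cong (λ u → at a u (s + d)) (sym eq) ⟩
    at a (factor x j n) (s + d)  ≡⟨ at-factor a x j n s+d<n ⟩
    x (j + (s + d))              ∎
    where
    open ≡-Reasoning
    d = suc (length vs)
    s<n : s < n
    s<n = ≤-<-trans (m≤m+n s d) s+d<n

  HasPeriod-mod : (j n d : ℕ) .{{_ : NonZero d}} → HasPeriod x j n d →
                  ∀ {s} → s < n → x (j + s) ≡ x (j + s % d)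
  HasPeriod-mod j n d per {s} s<n = begin
    x (j + s)                    ≡⟨ cong (λ s → x (j + s)) s≡ ⟩
    x (j + (s % d + s / d * d))  ≡⟨ sym (repeat (s % d) (s / d) (subst (_< n) s≡ s<n)) ⟩
    x (j + s % d)                ∎
    where
    open ≡-Reasoning
    s≡ = m≡m%n+[m/n]*n s d
    repeat : ∀ r k → r + k * d < n → x (j + r) ≡ x (j + (r + k * d))
    repeat r zero    _  = cong (λ s → x (j + s)) (sym (+-identityʳ r))
    repeat r (suc k) lt =
      trans (repeat r k (≤-<-trans (+-monoʳ-≤ r (m≤n+m (k * d) d)) lt))
            (trans (per (r + k * d) (subst (_< n) shuffle lt)) (cong (λ s → x (j + s)) (sym shuffle)))
      where
      shuffle : r + (d + k * d) ≡ r + k * d + d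
      shuffle = solve (r ∷ d ∷ k ∷ [])

  HasPeriod⇒pow : (j e t : ℕ) → HasPeriod x j t (suc e) → factor x j t ≡ pow (x j) (factor x (suc j) e) t
  HasPeriod⇒pow j e t per =
    at-ext (x j) (factor x j t) (pow (x j) vs t) (trans (length-factor x j t) (sym (length-pow (x j) vs t))) ats
    where
    open ≡-Reasoning
    vs = factor x (suc j) e
    ats : ∀ s → s < length (factor x j t) → at (x j) (factor x j t) s ≡ at (x j) (pow (x j) vs t) s
    ats s lt = begin
      at (x j) (factor x j t) s                 ≡⟨ at-factor (x j) x j t s<t ⟩
      x (j + s)                                 ≡⟨ HasPeriod-mod j t (suc e) per s<t ⟩
      x (j + s % suc e)                         ≡⟨ sym (at-factor (x j) x j (suc e) (m%n<n s (suc e))) ⟩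
      at (x j) (x j ∷ vs) (s % suc e)           ≡⟨ cong (λ e → at (x j) (x j ∷ vs) (s % suc e)) (sym |vs|≡e) ⟩
      at (x j) (x j ∷ vs) (s % suc (length vs)) ≡⟨ sym (at-pow (x j) (x j) vs s<t) ⟩
      at (x j) (pow (x j) vs t) s               ∎
      where
      s<t = subst (s <_) (length-factor x j t) lt
      |vs|≡e = length-factor x (suc j) e

  HasPeriod-inner : (j n d J t : ℕ) → HasPeriod x j n d → j ≤ J → J + t ≤ j + n → HasPeriod x J t d
  HasPeriod-inner j n d J t per j≤J J+t≤j+n s s+d<t = begin
    x (J + s)            ≡⟨ cong (λ J → x (J + s)) (sym J≡) ⟩
    x (j + o + s)        ≡⟨ cong x (+-assoc j o s) ⟩
    x (j + (o + s))      ≡⟨ per (o + s) o+s+d<n ⟩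
    x (j + (o + s + d))  ≡⟨ cong x (trans (cong (_+_ j) (+-assoc o s d)) (sym (+-assoc j o (s + d)))) ⟩
    x (j + o + (s + d))  ≡⟨ cong (λ J → x (J + (s + d))) J≡ ⟩
    x (J + (s + d))      ∎
    where
    open ≡-Reasoning
    o = J ∸ j
    J≡ : j + o ≡ J
    J≡ = m+[n∸m]≡n j≤J
    o+t≤n : o + t ≤ n
    o+t≤n = +-cancelˡ-≤ j (o + t) n (subst (_≤ j + n) (trans (cong (_+ t) (sym J≡)) (+-assoc j o t)) J+t≤j+n)
    o+s+d<n : o + s + d < n
    o+s+d<n = subst (_< n) (sym (+-assoc o s d)) (<-≤-trans (+-monoʳ-< o s+d<t) o+t≤n)

  BelowE⇒HasPeriod : {q : ℚ} (j n : ℕ) → BelowE q (factor x j n) →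
                     ∃ λ e → HasPeriod x j n (suc e) × q ℚ.< + n ℚ./ suc e
  BelowE⇒HasPeriod {q} j n (a , vs , _ , (p , eq , refl) , q<p/d) =
    length vs ,
    pow⇒HasPeriod j n a vs (subst (λ p → factor x j n ≡ pow a vs p) p≡n eq) ,
    subst (λ p → q ℚ.< + p ℚ./ suc (length vs)) p≡n q<p/d
    where
    p≡n : p ≡ n
    p≡n = trans (sym (length-pow a vs p)) (trans (cong length (sym eq)) (length-factor x j n))

  HasPeriod⇒BelowE : {q : ℚ} (j e t : ℕ) → HasPeriod x j t (suc e) → q ℚ.< + t ℚ./ suc e →
                     BelowE q (factor x j t)
  HasPeriod⇒BelowE {q} j e t per q<t/d =
    x j , vs , + t ℚ./ suc (length vs) , (t , HasPeriod⇒pow j e t per , refl) ,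
    subst (λ e → q ℚ.< + t ℚ./ suc e) (sym (length-factor x (suc j) e)) q<t/d
    where vs = factor x (suc j) e

NonErasing : {k m : ℕ} → Morphism k m → Set
NonErasing h = ∀ a → 0 < length (h a)

Injective⇒NonErasing : {k m : ℕ} (h : Morphism k m) → Injective h → NonErasing h
Injective⇒NonErasing h inj a with h a in eq
... | []    with () ← inj (a ∷ []) [] (cong (_++ []) eq)
... | _ ∷ _ = s≤s z≤n

maxImageLength : {k m : ℕ} → Morphism k m → ℕ
maxImageLength {k} h = max 0 (map (length ∘ h) (allFin k))

length-image≤max : {k m : ℕ} (h : Morphism k m) (a : Fin k) → length (h a) ≤ maxImageLength h
length-image≤max h a = All.lookup (xs≤max 0 _) (∈-map⁺ (length ∘ h) (∈-allFin a))

length-ext≤ : {k m L : ℕ} (h : Morphism k m) → (∀ a → length (h a) ≤ L) →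
              ∀ u → length (ext h u) ≤ length u * L
length-ext≤ h bound []      = z≤n
length-ext≤ h bound (a ∷ u) = subst (_≤ _) (sym (length-++ (h a))) (+-mono-≤ (bound a) (length-ext≤ h bound u))

module Image {k m : ℕ} (h : Morphism k (suc m)) (w : InfWord (Fin k)) where

  x : InfWord (Fin (suc m))
  x = applyInf h w

  start : ℕ → ℕ
  start i = length (ext h (factor w 0 i))

  image-+ : ∀ i c → ext h (factor w 0 (i + c)) ≡ ext h (factor w 0 i) ++ ext h (factor w i c)
  image-+ i c = trans (cong (ext h) (factor-+ w 0 i c)) (concatMap-++ h (factor w 0 i) (factor w i c))

  start-+ : ∀ i c → start (i + c) ≡ start i + length (ext h (factor w i c))
  start-+ i c = trans (cong length (image-+ i c)) (length-++ (ext h (factor w 0 i)))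

  start-suc : ∀ i → start (suc i) ≡ start i + length (h (w i))
  start-suc i = begin
    start (suc i)                       ≡⟨ cong start (+-comm 1 i) ⟩
    start (i + 1)                       ≡⟨ start-+ i 1 ⟩
    start i + length (h (w i) ++ [])    ≡⟨ cong (λ u → start i + length u) (++-identityʳ (h (w i))) ⟩
    start i + length (h (w i))          ∎
    where open ≡-Reasoning

  start-mono : ∀ {i i'} → i ≤ i' → start i ≤ start i'
  start-mono {i} i≤i' = subst (λ i' → start i ≤ start i') (m+[n∸m]≡n i≤i')
                              (subst (start i ≤_) (sym (start-+ i _)) (m≤m+n _ _))

  at-image-prefix : ∀ {i i' p} → i ≤ i' → p < start i →
                    at Fin.zero (ext h (factor w 0 i')) p ≡ at Fin.zero (ext h (factor w 0 i)) p
  at-image-prefix {i} {p = p} i≤i' p<start =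
    subst (λ i' → at Fin.zero (ext h (factor w 0 i')) p ≡ at Fin.zero (ext h (factor w 0 i)) p) (m+[n∸m]≡n i≤i')
          (trans (cong (λ u → at Fin.zero u p) (image-+ i _)) (at-++ˡ Fin.zero (ext h (factor w 0 i)) _ p<start))

  module _ (ne : NonErasing h) where

    length≤length-ext : ∀ u → length u ≤ length (ext h u)
    length≤length-ext []      = z≤n
    length≤length-ext (a ∷ u) = subst (suc (length u) ≤_) (sym (length-++ (h a)))
                                      (+-mono-≤ (ne a) (length≤length-ext u))

    start-< : ∀ i → start i < start (suc i)
    start-< i = subst (start i <_) (sym (start-suc i)) (m<m+n (start i) (ne (w i)))

    locate : ∀ p → ∃ λ i → start i ≤ p × p < start (suc i)
    locate zero = 0 , z≤n , start-< 0
    locate (suc p) with locate p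
    ... | i , start≤p , p<start with suc p <? start (suc i)
    ...   | yes lt = i , m≤n⇒m≤1+n start≤p , lt
    ...   | no  ≮  = suc i , ≮⇒≥ ≮ , ≤-<-trans p<start (start-< (suc i))

    applyInf-at : ∀ i {p} → p < start i → x p ≡ at Fin.zero (ext h (factor w 0 i)) p
    applyInf-at i {p} p<start with ≤-total i (suc p)
    ... | inj₁ i≤1+p = at-image-prefix i≤1+p p<start
    ... | inj₂ 1+p≤i = sym (at-image-prefix 1+p≤i p<start₁₊ₚ)
      where
      p<start₁₊ₚ : p < start (suc p)
      p<start₁₊ₚ = subst (_≤ start (suc p)) (length-factor w 0 (suc p)) (length≤length-ext (factor w 0 (suc p)))

    factor-applyInf : ∀ i n → factor x (start i) (length (ext h (factor w i n))) ≡ ext h (factor w i n)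
    factor-applyInf i n = at-ext Fin.zero _ y (length-factor x (start i) (length y)) ats
      where
      open ≡-Reasoning
      prefix = ext h (factor w 0 i)
      y = ext h (factor w i n)
      ats : ∀ p → p < length (factor x (start i) (length y)) →
            at Fin.zero (factor x (start i) (length y)) p ≡ at Fin.zero y p
      ats p lt = begin
        at Fin.zero (factor x (start i) (length y)) p           ≡⟨ at-factor Fin.zero x (start i) (length y) p<y ⟩
        x (start i + p)                                         ≡⟨ applyInf-at (i + n) inImage ⟩
        at Fin.zero (ext h (factor w 0 (i + n))) (start i + p)  ≡⟨ cong (λ u → at Fin.zero u (start i + p)) (image-+ i n) ⟩
        at Fin.zero (prefix ++ y) (start i + p)                 ≡⟨ at-++-≥ Fin.zero prefix y (m≤m+n (start i) p) ⟩
        at Fin.zero y (start i + p ∸ start i)                   ≡⟨ cong (at Fin.zero y) (m+n∸m≡n (start i) p) ⟩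
        at Fin.zero y p                                         ∎
        where
        p<y = subst (p <_) (length-factor x (start i) (length y)) lt
        inImage = subst (start i + p <_) (sym (start-+ i n)) (+-monoʳ-< (start i) p<y)

    innerImage : ∀ {L} → (∀ a → length (h a) ≤ L) → ∀ j n → L ≤ n →
                 ∃₂ λ i c → j ≤ start i × start i + length (ext h (factor w i c)) ≤ j + n
                                        × n ≤ length (ext h (factor w i c)) + (L + L)
    innerImage {L} bound j n L≤n with locate j | locate (j + n)
    ... | i₀ , start₀≤j , j<start | i₂ , start₂≤ , <start₂₊₁ = i , i₂ ∸ i , <⇒≤ j<start , inside , long
      where
      i = suc i₀
      y = ext h (factor w i (i₂ ∸ i))
      start≤j+L : start i ≤ j + L
      start≤j+L = subst (_≤ j + L) (sym (start-suc i₀)) (+-mono-≤ start₀≤j (bound (w i₀)))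
      i≤i₂ : i ≤ i₂
      i≤i₂ with i ≤? i₂
      ... | yes i≤i₂ = i≤i₂
      ... | no  i≰i₂ = ⊥-elim (<⇒≱ (+-cancelˡ-< j n L j+n<j+L) L≤n)
        where
        j+n<j+L = <-≤-trans <start₂₊₁ (≤-trans (start-mono (≰⇒> i≰i₂)) start≤j+L)
      start₂≡ : start i + length y ≡ start i₂
      start₂≡ = trans (sym (start-+ i (i₂ ∸ i))) (cong start (m+[n∸m]≡n i≤i₂))
      inside : start i + length y ≤ j + n
      inside = subst (_≤ j + n) (sym start₂≡) start₂≤
      shuffle : ∀ a b c → a + b + c + b ≡ a + (c + (b + b))
      shuffle a b c = solve (a ∷ b ∷ c ∷ [])
      long : n ≤ length y + (L + L)
      long = +-cancelˡ-≤ j n _ (<⇒≤ (begin-strict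
        j + n                         <⟨ <start₂₊₁ ⟩
        start (suc i₂)                ≡⟨ start-suc i₂ ⟩
        start i₂ + length (h (w i₂))  ≤⟨ +-mono-≤ (≤-reflexive (sym start₂≡)) (bound (w i₂)) ⟩
        start i + length y + L        ≤⟨ +-monoˡ-≤ L (+-monoˡ-≤ (length y) start≤j+L) ⟩
        j + L + length y + L          ≡⟨ shuffle j L (length y) ⟩
        j + (length y + (L + L))      ∎))
        where open ≤-Reasoning hiding (start)

-- Cross-multiplied form of: z/a < z'/b < n/c and n ≤ t + L give z/a < t/c once n is large.
<-shortened-ℕ : (z a z' b n t c L : ℕ) .{{_ : NonZero a}} →
                z * b < z' * a → z' * c < n * b → n ≤ t + L → L + z * (L * a * b) < n → z * c < t * a
<-shortened-ℕ z a z' b n t c L q<q' q'<n/c n≤t+L large with c ≤? L * a * b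
... | yes c≤Lab = begin-strict
  z * c            ≤⟨ *-monoʳ-≤ z c≤Lab ⟩
  z * (L * a * b)  <⟨ +-cancelˡ-< L _ t (<-≤-trans large (≤-trans n≤t+L (≤-reflexive (+-comm t L)))) ⟩
  t                ≤⟨ m≤m*n t a ⟩
  t * a            ∎
  where open ≤-Reasoning
... | no  c≰Lab = *-cancelˡ-< b (z * c) (t * a) (begin-strict
  b * (z * c)    ≡⟨ solve (b ∷ z ∷ c ∷ []) ⟩
  z * b * c      ≤⟨ m≤m+n (z * b * c) a ⟩
  z * b * c + a  <⟨ +-cancelʳ-< c _ _ chain ⟩
  t * b * a      ≡⟨ solve (t ∷ b ∷ a ∷ []) ⟩
  b * (t * a)    ∎)
  where
  open ≤-Reasoning
  chain : z * b * c + a + c < t * b * a + c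
  chain = begin-strict
    z * b * c + a + c      ≡⟨ solve (z ∷ b ∷ c ∷ a ∷ []) ⟩
    suc (z * b) * c + a    ≤⟨ +-monoˡ-≤ a (*-monoˡ-≤ c q<q') ⟩
    z' * a * c + a         ≡⟨ solve (z' ∷ a ∷ c ∷ []) ⟩
    suc (z' * c) * a       ≤⟨ *-monoˡ-≤ a q'<n/c ⟩
    n * b * a              ≤⟨ *-monoˡ-≤ a (*-monoˡ-≤ b n≤t+L) ⟩
    (t + L) * b * a        ≡⟨ solve (t ∷ L ∷ b ∷ a ∷ []) ⟩
    t * b * a + L * a * b  <⟨ +-monoʳ-< (t * b * a) (≰⇒> c≰Lab) ⟩
    t * b * a + c          ∎

<-/suc⇒ : (q : ℚ) (t e : ℕ) → q ℚ.< + t ℚ./ suc e → ↥ q ℤ.* + suc e ℤ.< + t ℤ.* ↧ q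
<-/suc⇒ q@(mkℚ _ _ _) t e q<t/d
  with ℚᵘ.<-respʳ-≃ (ℚ.toℚᵘ-fromℚᵘ (ℚᵘ.mkℚᵘ (+ t) e)) (ℚ.toℚᵘ-mono-< q<t/d)
... | ℚᵘ.*<* lt = lt

<-/suc⇐ : (q : ℚ) (t e : ℕ) → ↥ q ℤ.* + suc e ℤ.< + t ℤ.* ↧ q → q ℚ.< + t ℚ./ suc e
<-/suc⇐ q@(mkℚ _ _ _) t e lt =
  ℚ.toℚᵘ-cancel-< (ℚᵘ.<-respʳ-≃ (ℚᵘ.≃-sym (ℚ.toℚᵘ-fromℚᵘ (ℚᵘ.mkℚᵘ (+ t) e))) (ℚᵘ.*<* lt))

<-shortened : (q q' : ℚ) (L : ℕ) → q ℚ.< q' →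
              ∃ λ T → ∀ n t e → q' ℚ.< + n ℚ./ suc e → n ≤ t + L → T ≤ n → q ℚ.< + t ℚ./ suc e
<-shortened q@(mkℚ -[1+ _ ] D _) q' L _ =
  0 , λ n t e _ _ _ → <-/suc⇐ q t e (subst (_ ℤ.<_) (ℤ.pos-* t (suc D)) ℤ.-<+)
<-shortened q@(mkℚ (+ z) D _) q'@(mkℚ (+ z') D' _) L (ℚ.*<* q<q') =
  suc (L + z * (L * suc D * suc D')) , λ n t e q'<n/c n≤t+L large →
    <-/suc⇐ q t e (fromℕ z (suc e) t (suc D)
      (<-shortened-ℕ z (suc D) z' (suc D') n t (suc e) L (toℕ z (suc D') z' (suc D) q<q')
                     (toℕ z' (suc e) n (suc D') (<-/suc⇒ q' n e q'<n/c)) n≤t+L large))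
  where
  toℕ : ∀ a b c d → + a ℤ.* + b ℤ.< + c ℤ.* + d → a * b < c * d
  toℕ a b c d lt = ℤ.drop‿+<+ (subst₂ ℤ._<_ (sym (ℤ.pos-* a b)) (sym (ℤ.pos-* c d)) lt)
  fromℕ : ∀ a b c d → a * b < c * d → + a ℤ.* + b ℤ.< + c ℤ.* + d
  fromℕ a b c d lt = subst₂ ℤ._<_ (ℤ.pos-* a b) (ℤ.pos-* c d) (ℤ.+<+ lt)
<-shortened (mkℚ (+ z) _ _) (mkℚ -[1+ _ ] D' _) L (ℚ.*<* q<q')
  with () ← subst (ℤ._< _) (sym (ℤ.pos-* z (suc D'))) q<q'

ImageFactorsAbove : {k m : ℕ} → Morphism k m → InfWord (Fin k) → ℕ → ℚ → Set
ImageFactorsAbove h w n q = ∃ λ i → BelowE q (ext h (factor w i n))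

module _ {k m : ℕ} (h : Morphism k (suc m)) (w : InfWord (Fin k)) (ne : NonErasing h) where

  open Image h w

  private
    L : ℕ
    L = maxImageLength h
    instance
      L-nonZero : NonZero L
      L-nonZero = >-nonZero (<-≤-trans (ne (w 0)) (length-image≤max h (w 0)))
    L≤threshold : ∀ T N → L ≤ T + (N * L + (L + L))
    L≤threshold T N = ≤-trans (m≤n+m L L) (≤-trans (m≤n+m (L + L) (N * L)) (m≤n+m _ T))

  BelowLimsup-image⇒BelowACE : ∀ {q} → BelowLimsup (ImageFactorsAbove h w) q → BelowACE x q
  BelowLimsup-image⇒BelowACE (q' , q<q' , often) = q' , q<q' , λ N → asFactorOfImage (often N)
    where
    asFactorOfImage : ∀ {N} → Σ ℕ (λ n → N ≤ n × ImageFactorsAbove h w n q') →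
                      Σ ℕ (λ n → N ≤ n × ∃ λ j → BelowE q' (factor x j n))
    asFactorOfImage {N} (n , N≤n , i , above) =
      length (ext h (factor w i n)) ,
      ≤-trans N≤n (subst (_≤ length (ext h (factor w i n))) (length-factor w i n)
                         (length≤length-ext ne (factor w i n))) ,
      start i , subst (BelowE q') (sym (factor-applyInf ne i n)) above

  BelowACE⇒BelowLimsup-image : ∀ {q} → BelowACE x q → BelowLimsup (ImageFactorsAbove h w) q
  BelowACE⇒BelowLimsup-image {q} (q' , q<q' , often) with ℚ.<-dense q<q'
  ... | q'' , q<q'' , q''<q' with <-shortened q'' q' (L + L) q''<q'
  ... | T , shortened = q'' , q<q'' , λ N → innerBlock N (often (T + (N * L + (L + L))))
    where
    innerBlock : ∀ N → Σ ℕ (λ n → T + (N * L + (L + L)) ≤ n × ∃ λ j → BelowE q' (factor x j n)) →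
                 Σ ℕ (λ n → N ≤ n × ImageFactorsAbove h w n q'')
    innerBlock N (n , large , j , above) with BelowE⇒HasPeriod x j n above
    ... | e , per , q'<n/d with innerImage ne (length-image≤max h) j n (≤-trans (L≤threshold T N) large)
    ... | i , c , j≤start , inside , long =
      c , N≤c , i ,
      subst (BelowE q'') (factor-applyInf ne i c)
        (HasPeriod⇒BelowE x (start i) e t (HasPeriod-inner x j n (suc e) (start i) t per j≤start inside)
                          (shortened n t e q'<n/d long (≤-trans (m≤m+n T _) large)))
      where
      t = length (ext h (factor w i c))
      NL+2L≤n : N * L + (L + L) ≤ n
      NL+2L≤n = ≤-trans (m≤n+m _ T) large
      N≤c : N ≤ c
      N≤c = *-cancelʳ-≤ N c L (≤-trans (+-cancelʳ-≤ (L + L) (N * L) t (≤-trans NL+2L≤n long))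
                                       (subst (λ c → t ≤ c * L) (length-factor w i c)
                                              (length-ext≤ h (length-image≤max h) (factor w i c))))

mainTheorem10 : (k m : ℕ) (w : ℕ → Fin (suc (suc k))) (q : ℚ) →
    BelowACE-I k m w q ⇔ BelowRHS k m w q
mainTheorem10 k m w q = mk⇔
  (λ (h , inj , ace) → h , inj , BelowACE⇒BelowLimsup-image h w (Injective⇒NonErasing h inj) ace)
  (λ (h , inj , rhs) → h , inj , BelowLimsup-image⇒BelowACE h w (Injective⇒NonErasing h inj) rhs)
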